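{- Let $I_{\mathcal C}$ be a propositional action-based interpreted system and, for a set $\tilde\Phi\subseteq\Phi$ of visible propositions, let $\tilde I_{\mathcal C}$ be its abstract interpreted system (both as described in the context). Then $I_{\mathcal C}\preceq\tilde I_{\mathcal C}$, i.e. $\tilde I_{\mathcal C}$ simulates $I_{\mathcal C}$.
   Context: Concrete system $I_{\mathcal C}$ (as derived from an access control policy): agents $\Omega=\{e\}\cup\Sigma_{Ag}$; each agent $i$ has a finite set $\Phi_i$ of Boolean propositions, pairwise disjoint, $\Phi=\bigcup_i\Phi_i$. Local states $L_i$ are valuations of $\Phi_i$, global states $S=L_e\times\prod_{i}L_i$ (valuations of $\Phi$), $l_i(s)$ the $i$-component, $\gamma(s,p)$ the value of $p$ in $s$; $S_0\subseteq S$ initial states. There is a finite set of actions; each action $\alpha:\varepsilon\leftarrow\ell$ belongs to an agent $\mathbf{Ag}(\alpha)$, has a guard $\ell$ (a propositional formula over $\Phi$) and an effect $\varepsilon$ (a set of signed propositions $+p,-p$, no proposition with both signs). For $st\subseteq S$, $\Theta_\alpha(st)=\{s[p\mapsto\top\mid +p\in\varepsilon][p\mapsto\bot\mid -p\in\varepsilon] : s\in st,\ s\models\ell\}$. The system is asynchronous (each step performs one action; protocols allow all actions), with $\tau(\alpha,s)=s'$ iff $\Theta_\alpha(\{s\})=\{s'\}$. Reachability: from $S_0$ by finitely many transitions; $s\sim_i s'$ iff $l_i(s)=l_i(s')$ and both reachable. Abstract system $\tilde I_{\mathcal C}$: let $\tilde\Phi_i=\tilde\Phi\cap\Phi_i$.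 Define $l\,\Re_i\,l'$ on $L_i$ iff $l,l'$ agree on all $p\in\tilde\Phi_i$, $h_i:L_i\to L_i/\Re_i$ the quotient map, $\tilde L_i=L_i/\Re_i$, $\tilde S=\prod_i\tilde L_i$, $h(s)=(h_i(l_i(s)))_i$; the value of $p\in\tilde\Phi_i$ at an abstract local state is its value at any representative. For actions, $\alpha':\varepsilon'\leftarrow\ell'\in[\alpha]$ iff $\mathbf{Ag}(\alpha')=\mathbf{Ag}(\alpha)$, $\{\pm p\in\varepsilon':p\in\tilde\Phi\}=\{\pm p\in\varepsilon:p\in\tilde\Phi\}$ and $\exists(\Phi\setminus\tilde\Phi).\ell'\equiv\exists(\Phi\setminus\tilde\Phi).\ell$, where $\exists x.f=f[\bot/x]\vee f[\top/x]$ extended to sets. The abstract actions are the classes $[\alpha]$, owned by $\mathbf{Ag}(\alpha)$, with effect $\tilde\varepsilon=\{\pm p\in\varepsilon:p\in\tilde\Phi\}$ and guard $\tilde\ell=\exists(\Phi\setminus\tilde\Phi).\ell$; abstract transitions $\tilde\tau(\tilde\alpha,\tilde s)=\tilde s'$ iff $\tilde\Theta_{\tilde\alpha}(\{\tilde s\})=\{\tilde s'\}$, with $\tilde\Theta$ defined as $\Theta$ but over valuations of $\tilde\Phi$; $\tilde S_0=\{h(s):s\in S_0\}$; the abstract system is asynchronous with all actions allowed. Reachability and $\sim_i$ in $\tilde I_{\mathcal C}$ are defined analogously. Simulation: $H\subseteq S\times\tilde S$ is a simulation relation if (1) every $s_0\in S_0$ has some $\tilde s_0\in\tilde S_0$ with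 $(s_0,\tilde s_0)\in H$; and for all $(s,\tilde s)\in H$: (2) $\gamma(s,p)=\tilde\gamma(\tilde s,p)$ for all $p\in\tilde\Phi$; (3) if $\tau(\alpha,s)=s'$ then there are $\tilde\alpha,\tilde s'$ with $\tilde\tau(\tilde\alpha,\tilde s)=\tilde s'$ and $(s',\tilde s')\in H$; (4) if $s\sim_i s'$ then there is $\tilde s'$ with $\tilde s\sim_i\tilde s'$ and $(s',\tilde s')\in H$. $I\preceq\tilde I$ means such $H$ exists. -}

module Defs where

open import Level using (0ℓ)
open import Data.Nat using (ℕ; suc)
open import Data.Fin using (Fin; zero; _≟_)
open import Data.Fin.Subset using (Subset; _∈_; _∉_)
open import Data.Fin.Subset.Properties using (_∈?_)
open import Data.Bool using (Bool; true; false; if_then_else_)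
import Data.Bool as B
open import Data.Maybe using (Maybe; just; nothing; maybe′)
open import Data.Vec using (Vec; lookup; tabulate)
open import Data.List using (List; []; _∷_; filter; allFin)
open import Data.Product using (Σ; _×_; _,_)
open import Relation.Nullary using (yes; no; ¬_)
open import Relation.Nullary.Decidable using (¬?; ⌊_⌋)
open import Relation.Binary.PropositionalEquality using (_≡_)

data Form (m : ℕ) : Set where
  var       : Fin m → Form m
  tt ff     : Form m
  ¬f_       : Form m → Form m
  _∧f_ _∨f_ : Form m → Form m → Form m

Val : ℕ → Set
Val m = Vec Bool m

eval : ∀ {m} → Val m → Form m → Bool
eval v (var p)  = lookup v p
eval v tt       = true
eval v ff       = false
eval v (¬f f)   = B.not (eval v f)
eval v (f ∧f g) = eval v f B.∧ eval v g
eval v (f ∨f g) = eval v f B.∨ eval v g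

_⊨_ : ∀ {m} → Val m → Form m → Set
v ⊨ f = eval v f ≡ true

const : ∀ {m} → Bool → Form m
const true  = tt
const false = ff

subst : ∀ {m} → Fin m → Bool → Form m → Form m
subst x b (var q) with q ≟ x
... | yes _ = const b
... | no  _ = var q
subst x b tt       = tt
subst x b ff       = ff
subst x b (¬f f)   = ¬f subst x b f
subst x b (f ∧f g) = subst x b f ∧f subst x b g
subst x b (f ∨f g) = subst x b f ∨f subst x b g

∃₁ : ∀ {m} → Fin m → Form m → Form m
∃₁ x f = subst x false f ∨f subst x true f

∃* : ∀ {m} → List (Fin m) → Form m → Form m
∃* []       f = f
∃* (x ∷ xs) f = ∃₁ x (∃* xs f)

hidden : ∀ {m} → Subset m → List (Fin m)
hidden {m} vis = filter (λ p → ¬? (p ∈? vis)) (allFin m)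

-- Actions α : ε ← ℓ.  An effect assigns to each proposition p:
-- just true = +p, just false = -p, nothing = p not mentioned
-- (so no proposition occurs with both signs).

Effect : ℕ → Set
Effect m = Fin m → Maybe Bool

record Action (nAgents m : ℕ) : Set where
  field
    owner  : Fin nAgents
    guard  : Form m
    effect : Effect m

apply : ∀ {m} → Effect m → Val m → Val m
apply ε s = tabulate (λ p → maybe′ (λ b → b) (lookup s p) (ε p))

-- Agents Ω = Fin (suc k); agent zero is the environment e,
-- the others form Σ_Ag.  Each proposition has exactly one owner,
-- so Φ_i = { p | propOwner p ≡ i } are pairwise disjoint.

record ISystem : Set₁ where
  field
    k         : ℕ
    m         : ℕ
    propOwner : Fin m → Fin (suc k)
    S₀        : Val m → Set
    nAct      : ℕ
    act       : Fin nAct → Action (suc k) m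

Agent : ISystem → Set
Agent I = Fin (suc (ISystem.k I))

env : ∀ {I} → Agent I
env = zero

module Concrete (I : ISystem) where
  open ISystem I

  τ : Fin nAct → Val m → Val m → Set
  τ α s s' = (s ⊨ Action.guard (act α)) × (s' ≡ apply (Action.effect (act α)) s)

  data Reach : Val m → Set where
    init : ∀ {s} → S₀ s → Reach s
    step : ∀ {s s'} α → Reach s → τ α s s' → Reach s'

  sameLocal : Agent I → Val m → Val m → Set
  sameLocal i s s' = ∀ p → propOwner p ≡ i → lookup s p ≡ lookup s' p

  _∼[_]_ : Val m → Agent I → Val m → Set
  s ∼[ i ] s' = sameLocal i s s' × Reach s × Reach s'

-- An abstract global state is represented by a valuation of Φ, taken
-- modulo the setoid equality _≈̃_ (agreement on Φ̃); this is the quotient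
-- Π_i L_i/ℜ_i, and h is the identity map into this setoid.

module Abstract (I : ISystem) (vis : Subset (ISystem.m I)) where
  open ISystem I

  _≈̃_ : Val m → Val m → Set
  s ≈̃ t = ∀ p → p ∈ vis → lookup s p ≡ lookup t p

  absEffect : Effect m → Effect m
  absEffect ε p = if ⌊ p ∈? vis ⌋ then ε p else nothing

  absGuard : Form m → Form m
  absGuard ℓ = ∃* (hidden vis) ℓ

  SameClass : Fin nAct → Fin nAct → Set
  SameClass α α' =
      (Action.owner (act α') ≡ Action.owner (act α))
    × (∀ p → p ∈ vis → absEffect (Action.effect (act α')) p ≡ absEffect (Action.effect (act α)) p)
    × (∀ v → eval v (absGuard (Action.guard (act α'))) ≡ eval v (absGuard (Action.guard (act α))))

  -- Abstract actions are the classes [α], represented by a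
  -- representative α; effect and guard below only depend on the class.
  AbsAct : Set
  AbsAct = Fin nAct

  τ̃ : AbsAct → Val m → Val m → Set
  τ̃ α s̃ s̃' = (s̃ ⊨ absGuard (Action.guard (act α)))
             × (s̃' ≈̃ apply (absEffect (Action.effect (act α))) s̃)

  S̃₀ : Val m → Set
  S̃₀ s̃ = Σ (Val m) (λ s → S₀ s × (s ≈̃ s̃))

  data Reach̃ : Val m → Set where
    init : ∀ {s̃} → S̃₀ s̃ → Reach̃ s̃
    step : ∀ {s̃ s̃'} α̃ → Reach̃ s̃ → τ̃ α̃ s̃ s̃' → Reach̃ s̃'

  sameLocal̃ : Agent I → Val m → Val m → Set
  sameLocal̃ i s t = ∀ p → propOwner p ≡ i → p ∈ vis → lookup s p ≡ lookup t p

  _∼̃[_]_ : Val m → Agent I → Val m → Set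
  s ∼̃[ i ] t = sameLocal̃ i s t × Reach̃ s × Reach̃ t

module _ (I : ISystem) (vis : Subset (ISystem.m I)) where
  open ISystem I
  open Concrete I
  open Abstract I vis

  record IsSimulation (H : Val m → Val m → Set) : Set where
    field
      sim-init : ∀ s₀ → S₀ s₀ → Σ (Val m) (λ s̃₀ → S̃₀ s̃₀ × H s₀ s̃₀)
      sim-val  : ∀ s s̃ → H s s̃ → ∀ p → p ∈ vis → lookup s p ≡ lookup s̃ p
      sim-step : ∀ s s̃ → H s s̃ → ∀ α s' → τ α s s' →
                 Σ AbsAct (λ α̃ → Σ (Val m) (λ s̃' → τ̃ α̃ s̃ s̃' × H s' s̃'))
      sim-epi  : ∀ s s̃ → H s s̃ → ∀ (i : Agent I) s' → s ∼[ i ] s' →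
                 Σ (Val m) (λ s̃' → s̃ ∼̃[ i ] s̃' × H s' s̃')

  Simulated : Set₁
  Simulated = Σ (Val m → Val m → Set) IsSimulation

module Submission where

-- The abstraction map h sends a concrete state s to its class modulo
-- agreement on the visible propositions Φ̃; abstract states are represented
-- by valuations, so h is the identity on representatives.  The simulation
-- relation is the graph of h restricted to reachable states:
--   H s s̃  :⇔  s̃ = s  and  s is reachable.
-- The proof rests on one observation: every concrete transition τ(α,s)=s'
-- is also an abstract transition τ̃([α],s)=s'.  This needs
--   (1) a propositional fact: a valuation satisfying ℓ satisfies ∃X.ℓ for
--       any list X of variables (substituting a variable by its own value
--       does not change the truth value), so s ⊨ ℓ gives s ⊨ ℓ̃;
--   (2) a fact about effects: applying ε and its visible part ε̃ yields
--       states agreeing on Φ̃.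
-- Consequently concrete reachability implies abstract reachability, which
-- turns the epistemic clause s ∼ᵢ s' into s ∼̃ᵢ s'; all four simulation
-- clauses then follow directly.

open import Defs
open import Data.Fin using (Fin; _≟_)
open import Data.Fin.Subset using (Subset; _∈_)
open import Data.Fin.Subset.Properties using (_∈?_)
open import Data.Bool using (Bool; true; false)
import Data.Bool as B
open import Data.Bool.Properties using (∨-zeroʳ)
open import Data.Maybe using (maybe′)
open import Data.List using (List; []; _∷_)
open import Data.Vec using (lookup)
open import Data.Vec.Properties using (lookup∘tabulate)
open import Data.Product using (_,_)
open import Data.Empty using (⊥-elim)
open import Relation.Nullary using (yes; no)
open import Relation.Binary.PropositionalEquality
  using (_≡_; refl; sym; trans; cong; cong₂; module ≡-Reasoning)
open ≡-Reasoning

eval-const : ∀ {m} (v : Val m) (b : Bool) → eval v (const b) ≡ b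
eval-const v true  = refl
eval-const v false = refl

eval-subst-self : ∀ {m} (v : Val m) {x : Fin m} {b : Bool} →
                  lookup v x ≡ b → ∀ f → eval v (subst x b f) ≡ eval v f
eval-subst-self v {x} vx≡b (var q) with q ≟ x
... | yes refl = trans (eval-const v _) (sym vx≡b)
... | no  _    = refl
eval-subst-self v vx≡b tt       = refl
eval-subst-self v vx≡b ff       = refl
eval-subst-self v vx≡b (¬f f)   = cong B.not (eval-subst-self v vx≡b f)
eval-subst-self v vx≡b (f ∧f g) =
  cong₂ B._∧_ (eval-subst-self v vx≡b f) (eval-subst-self v vx≡b g)
eval-subst-self v vx≡b (f ∨f g) =
  cong₂ B._∨_ (eval-subst-self v vx≡b f) (eval-subst-self v vx≡b g)

-- Existential introduction: a model of f is a model of ∃x.f; the disjunct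
-- matching the value of x under v is the one that holds.
∃₁-intro : ∀ {m} (v : Val m) (x : Fin m) (f : Form m) → v ⊨ f → v ⊨ ∃₁ x f
∃₁-intro v x f v⊨f with lookup v x in vx
... | false = cong (B._∨ eval v (subst x true f)) (trans (eval-subst-self v vx f) v⊨f)
... | true  = begin
  eval v (subst x false f) B.∨ eval v (subst x true f)
    ≡⟨ cong (eval v (subst x false f) B.∨_) (trans (eval-subst-self v vx f) v⊨f) ⟩
  eval v (subst x false f) B.∨ true
    ≡⟨ ∨-zeroʳ _ ⟩
  true ∎

∃*-intro : ∀ {m} (v : Val m) (xs : List (Fin m)) (f : Form m) → v ⊨ f → v ⊨ ∃* xs f
∃*-intro v []       f v⊨f = v⊨f
∃*-intro v (x ∷ xs) f v⊨f = ∃₁-intro v x (∃* xs f) (∃*-intro v xs f v⊨f)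

module _ (I : ISystem) (vis : Subset (ISystem.m I)) where
  open ISystem I
  open Concrete I
  open Abstract I vis

  absEffect-visible : ∀ (ε : Effect m) p → p ∈ vis → absEffect ε p ≡ ε p
  absEffect-visible ε p p∈vis with p ∈? vis
  ... | yes _     = refl
  ... | no  p∉vis = ⊥-elim (p∉vis p∈vis)

  apply-absEffect : ∀ (ε : Effect m) s → apply ε s ≈̃ apply (absEffect ε) s
  apply-absEffect ε s p p∈vis = begin
    lookup (apply ε s) p                        ≡⟨ lookup∘tabulate _ p ⟩
    maybe′ (λ b → b) (lookup s p) (ε p)
      ≡⟨ cong (maybe′ (λ b → b) (lookup s p)) (absEffect-visible ε p p∈vis) ⟨
    maybe′ (λ b → b) (lookup s p) (absEffect ε p) ≡⟨ lookup∘tabulate _ p ⟨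
    lookup (apply (absEffect ε) s) p            ∎

  τ⇒τ̃ : ∀ α {s s'} → τ α s s' → τ̃ α s s'
  τ⇒τ̃ α {s} (s⊨ℓ , refl) =
    ∃*-intro s (hidden vis) (Action.guard (act α)) s⊨ℓ ,
    apply-absEffect (Action.effect (act α)) s

  Reach⇒Reach̃ : ∀ {s} → Reach s → Reach̃ s
  Reach⇒Reach̃ (init s₀) = init (_ , s₀ , λ _ _ → refl)
  Reach⇒Reach̃ (step α r t) = step α (Reach⇒Reach̃ r) (τ⇒τ̃ α t)

  data GraphOfH (s : Val m) : Val m → Set where
    reachable : Reach s → GraphOfH s s

  graphOfH-isSimulation : IsSimulation I vis GraphOfH
  graphOfH-isSimulation = record
    { sim-init = λ s₀ s₀∈S₀ → s₀ , (s₀ , s₀∈S₀ , λ _ _ → refl) , reachable (init s₀∈S₀)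
    ; sim-val  = λ { s .s (reachable _) p _ → refl }
    ; sim-step = λ { s .s (reachable r) α s' t →
                     α , s' , τ⇒τ̃ α t , reachable (step α r t) }
    ; sim-epi  = λ { s .s (reachable _) i s' (same , r , r') →
                     s' , ((λ p owns _ → same p owns) , Reach⇒Reach̃ r , Reach⇒Reach̃ r')
                        , reachable r' }
    }

proposition2 : (I : ISystem) (vis : Subset (ISystem.m I)) → Simulated I vis
proposition2 I vis = GraphOfH I vis , graphOfH-isSimulation I vis
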